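{- Let $\mathfrak M_0=\langle S_0,L_0,\mathrm I_0\rangle$ be a partial linear space, $G$ a cyclic group which is $\mathbb Z$ or $C_k$ with $k$ even, $k>2$, and $\mathfrak M=\mathfrak M_0\circledast_\circ G=\langle M,\mathcal L,\mathrm I\rangle$. The pair $\varkappa=(\varkappa',\varkappa'')$, $\varkappa'\colon M\to\mathcal L$, $\varkappa''\colon\mathcal L\to M$, defined by $\varkappa'((i,x))=[1-i,x]$ and $\varkappa''([i,y])=(1-i,y)$, is an involutive correlation of $\mathfrak M$. Consequently $\mathfrak M$ is self dual.
   Context: PLS: incidence structure $\langle S,\mathcal L,\mathrm I\rangle$, $S\cap\mathcal L=\emptyset$, every line on at least two points, every point on at least two lines, two distinct points on at most one common line. A correlation of a structure is a pair $(\varkappa',\varkappa'')$ of bijections points$\to$lines and lines$\to$points with $a\,\mathrm I\,l\iff\varkappa''(l)\,\mathrm I\,\varkappa'(a)$; involutive means $\varkappa''\varkappa'=\mathrm{id}$ and $\varkappa'\varkappa''=\mathrm{id}$; self dual means a correlation exists. Dual multiplying $\mathfrak M_0\circledast_\circ G$: point set $\bigcup_{i\in G}M_i$, line set $\bigcup_{i\in G}\mathcal L_i$, where $M_i=\{i\}\times S_0$, $\mathcal L_i=\{i\}\times L_0$ for even $i$ and $M_i=\{i\}\times L_0$, $\mathcal L_i=\{i\}\times S_0$ for odd $i$; points are written $(i,a)$, lines $[j,b]$, and $(i,a)\,\mathrm I\,[j,b]$ iff either $i=j$ and ($a\,\mathrm I_0\,b$ or $b\,\mathrm I_0\,a$),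 or $i=j+1$ and $a=b$. -}

module Defs where

open import Data.Nat as ℕ using (ℕ; zero; suc; _%_; _≡ᵇ_; _∸_)
open import Data.Nat.DivMod using (_mod_)
open import Data.Integer as ℤ using (ℤ; ∣_∣)
open import Data.Fin using (Fin; toℕ)
open import Data.Bool using (Bool; true; false; not)
open import Data.Sum using (_⊎_; inj₁; inj₂)
open import Data.Product using (Σ; _×_; _,_; ∃; ∃-syntax)
open import Data.Empty using (⊥)
open import Relation.Nullary using (¬_)
open import Relation.Binary.PropositionalEquality using (_≡_)
open import Function using (_∘_; id)
open import Function.Definitions using (Bijective)

record Structure : Set₁ where
  field
    Pt  : Set
    Ln  : Set
    _I_ : Pt → Ln → Set

open Structure public

-- S ∩ L = ∅ is automatic: points and lines are elements of distinct types.
IsPLS : Structure → Set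
IsPLS 𝔐 =
    (∀ (l : Ln 𝔐) → ∃[ a ] ∃[ b ] (¬ a ≡ b × _I_ 𝔐 a l × _I_ 𝔐 b l))
  × (∀ (a : Pt 𝔐) → ∃[ l ] ∃[ m ] (¬ l ≡ m × _I_ 𝔐 a l × _I_ 𝔐 a m))
  × (∀ (a b : Pt 𝔐) (l m : Ln 𝔐) → ¬ a ≡ b →
       _I_ 𝔐 a l → _I_ 𝔐 b l → _I_ 𝔐 a m → _I_ 𝔐 b m → l ≡ m)

IsCorrelation : (𝔐 : Structure) → (Pt 𝔐 → Ln 𝔐) → (Ln 𝔐 → Pt 𝔐) → Set
IsCorrelation 𝔐 κ′ κ″ =
    Bijective _≡_ _≡_ κ′
  × Bijective _≡_ _≡_ κ″
  × (∀ (a : Pt 𝔐) (l : Ln 𝔐) →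
       (_I_ 𝔐 a l → _I_ 𝔐 (κ″ l) (κ′ a)) × (_I_ 𝔐 (κ″ l) (κ′ a) → _I_ 𝔐 a l))

IsInvolutiveCorrelation : (𝔐 : Structure) → (Pt 𝔐 → Ln 𝔐) → (Ln 𝔐 → Pt 𝔐) → Set
IsInvolutiveCorrelation 𝔐 κ′ κ″ =
    IsCorrelation 𝔐 κ′ κ″
  × (∀ a → κ″ (κ′ a) ≡ a)
  × (∀ l → κ′ (κ″ l) ≡ l)

SelfDual : Structure → Set
SelfDual 𝔐 = ∃[ κ′ ] ∃[ κ″ ] IsCorrelation 𝔐 κ′ κ″

data CyclicGroup : Set where
  ℤG : CyclicGroup
  C  : ℕ → CyclicGroup

Elem : CyclicGroup → Set
Elem ℤG    = ℤ
Elem (C k) = Fin k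

incr : (G : CyclicGroup) → Elem G → Elem G
incr ℤG i = ℤ.1ℤ ℤ.+ i
incr (C (suc n)) i = (suc (toℕ i)) mod (suc n)

oneMinus : (G : CyclicGroup) → Elem G → Elem G
oneMinus ℤG i = ℤ.1ℤ ℤ.- i
oneMinus (C (suc n)) i = (suc (suc n) ∸ toℕ i) mod (suc n)

-- parity of an element (well defined on C_k because k is even)
isEven : (G : CyclicGroup) → Elem G → Bool
isEven ℤG    i = (∣ i ∣ % 2) ≡ᵇ 0
isEven (C k) i = (toℕ i % 2) ≡ᵇ 0

Admissible : CyclicGroup → Set
Admissible ℤG    = Data.Unit.⊤ where import Data.Unit
Admissible (C k) = (k % 2 ≡ 0) × (2 ℕ.< k)

-- The "elements" of 𝔐₀ are  S₀ ⊎ L₀  (inj₁ = point, inj₂ = line).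
-- M_i = {i} × S₀, 𝓛_i = {i} × L₀ for even i; swapped for odd i.
-- A pair (i , x) with x : S₀ ⊎ L₀ is a point iff x is of the kind
-- dictated by the parity of i.

isPointKind : ∀ {A B : Set} → A ⊎ B → Bool
isPointKind (inj₁ _) = true
isPointKind (inj₂ _) = false

module _ (𝔐₀ : Structure) (G : CyclicGroup) where
  private
    E = Pt 𝔐₀ ⊎ Ln 𝔐₀

  DMPoint : Set
  DMPoint = Σ (Elem G) λ i → Σ E λ x → isPointKind x ≡ isEven G i

  DMLine : Set
  DMLine = Σ (Elem G) λ i → Σ E λ x → isPointKind x ≡ not (isEven G i)

  SymI : E → E → Set
  SymI (inj₁ a) (inj₁ b) = ⊥
  SymI (inj₁ a) (inj₂ l) = _I_ 𝔐₀ a l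
  SymI (inj₂ l) (inj₁ a) = _I_ 𝔐₀ a l
  SymI (inj₂ l) (inj₂ m) = ⊥

  DMInc : DMPoint → DMLine → Set
  DMInc (i , a , _) (j , b , _) = (i ≡ j × SymI a b) ⊎ (i ≡ incr G j × a ≡ b)

  DualMultiply : Structure
  DualMultiply = record { Pt = DMPoint ; Ln = DMLine ; _I_ = DMInc }

-- The maps κ′((i,x)) = [1-i, x],  κ″([i,y]) = (1-i, y).
-- The parity side conditions are supplied as hypotheses: parity(1-i) = ¬ parity(i).
ParityFlip : CyclicGroup → Set
ParityFlip G = ∀ i → isEven G (oneMinus G i) ≡ not (isEven G i)

module _ (𝔐₀ : Structure) (G : CyclicGroup) (pf : ParityFlip G) where
  open import Relation.Binary.PropositionalEquality using (trans; sym; cong)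

  κ′ : DMPoint 𝔐₀ G → DMLine 𝔐₀ G
  κ′ (i , x , p) = oneMinus G i , x , trans p (trans (sym (notnot (isEven G i))) (cong not (sym (pf i))))
    where
      notnot : ∀ b → not (not b) ≡ b
      notnot true  = Relation.Binary.PropositionalEquality.refl
      notnot false = Relation.Binary.PropositionalEquality.refl

  κ″ : DMLine 𝔐₀ G → DMPoint 𝔐₀ G
  κ″ (i , y , p) = oneMinus G i , y , trans p (sym (pf i))

-- The map i ↦ 1 − i is an involution of G that reverses parity (this is
-- where k even is used) and turns the "shift" i = j + 1 into 1 − j = (1 − i) + 1.
-- Hence κ′ and κ″ are mutually inverse, the incidences inside a layer are swapped
-- (aI₀b becomes bI₀a) and the incidences between consecutive layers are kept.
-- A pair of mutually inverse maps that sends a I l to κ″ l I κ′ a is automatically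
-- an involutive correlation: the converse implication is the same statement applied
-- to κ″ l and κ′ a.
module Submission where

open import Defs
open import Data.Product using (_×_; _,_; proj₁)
open import Data.Nat using (ℕ; zero; suc; _+_; _∸_; _%_; _≡ᵇ_; s≤s; _≤_; _<_; parity)
open import Data.Nat.Properties
  using (m≤n⇒m<n∨m≡n; m∸n≤m; m∸[m∸n]≡n; +-∸-assoc; m+n∸n≡m; m+n≤o⇒n≤o)
open import Data.Nat.DivMod using (m≤n⇒m%n≡m; n%n≡0; [m+n]%n≡m%n)
open import Data.Parity.Base as ℙ using (Parity; 0ℙ; 1ℙ; _⁻¹)
open import Data.Parity.Properties using (suc-homo-⁻¹; ⁻¹-selfInverse; +-identityʳ)
open import Data.Integer as ℤ using (+_; -[1+_]; ∣_∣)
open import Data.Integer.Tactic.RingSolver using (solve-∀)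
open import Data.Fin using (Fin; toℕ)
open import Data.Fin.Properties using (toℕ-fromℕ<; toℕ-injective; toℕ≤pred[n])
open import Data.Bool using (Bool; true; false; not)
import Data.Bool.Properties as Bool
open import Data.Sum using (inj₁; inj₂)
open import Relation.Binary.PropositionalEquality
open import Function.Definitions using (Bijective)
open import Function.Consequences.Propositional
  using (inverseᵇ⇒bijective; strictlyInverseˡ⇒inverseˡ; strictlyInverseʳ⇒inverseʳ)
open import Axiom.UniquenessOfIdentityProofs using (module Decidable⇒UIP)

open ≡-Reasoning

mutualInverses⇒bijective : {A B : Set} {f : A → B} {g : B → A} →
  (∀ x → g (f x) ≡ x) → (∀ y → f (g y) ≡ y) → Bijective _≡_ _≡_ f
mutualInverses⇒bijective {f = f} gf fg =
  inverseᵇ⇒bijective (strictlyInverseˡ⇒inverseˡ f fg , strictlyInverseʳ⇒inverseʳ f gf)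

ReversesIncidence : (𝔐 : Structure) → (Pt 𝔐 → Ln 𝔐) → (Ln 𝔐 → Pt 𝔐) → Set
ReversesIncidence 𝔐 κ′ κ″ = ∀ a l → _I_ 𝔐 a l → _I_ 𝔐 (κ″ l) (κ′ a)

reversesIncidence⇒isInvolutiveCorrelation :
  (𝔐 : Structure) {κ′ : Pt 𝔐 → Ln 𝔐} {κ″ : Ln 𝔐 → Pt 𝔐} →
  (∀ a → κ″ (κ′ a) ≡ a) → (∀ l → κ′ (κ″ l) ≡ l) →
  ReversesIncidence 𝔐 κ′ κ″ → IsInvolutiveCorrelation 𝔐 κ′ κ″
reversesIncidence⇒isInvolutiveCorrelation 𝔐 {κ′} {κ″} κ″κ′ κ′κ″ reverses =
  ( mutualInverses⇒bijective κ″κ′ κ′κ″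
  , mutualInverses⇒bijective κ′κ″ κ″κ′
  , λ a l → reverses a l , reflects a l )
  , κ″κ′ , κ′κ″
  where
  reflects : ∀ a l → _I_ 𝔐 (κ″ l) (κ′ a) → _I_ 𝔐 a l
  reflects a l inc = subst₂ (_I_ 𝔐) (κ″κ′ a) (κ′κ″ l) (reverses (κ″ l) (κ′ a) inc)

record OneMinusLaws (G : CyclicGroup) : Set where
  field
    parityFlip          : ParityFlip G
    oneMinus-involutive : ∀ i → oneMinus G (oneMinus G i) ≡ i
    incr-oneMinus-incr  : ∀ j → incr G (oneMinus G (incr G j)) ≡ oneMinus G j

module _ (𝔐₀ : Structure) (G : CyclicGroup) (laws : OneMinusLaws G)
         (pf : ParityFlip G) where
  open OneMinusLaws laws using (oneMinus-involutive; incr-oneMinus-incr)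
  open Decidable⇒UIP Bool._≟_ using (≡-irrelevant)

  private
    𝔐 : Structure
    𝔐 = DualMultiply 𝔐₀ G

  point-≡ : ∀ {i i′} {x} {p q} → i ≡ i′ → _≡_ {A = DMPoint 𝔐₀ G} (i , x , p) (i′ , x , q)
  point-≡ {i} {x = x} refl = cong (λ r → i , x , r) (≡-irrelevant _ _)

  line-≡ : ∀ {i i′} {x} {p q} → i ≡ i′ → _≡_ {A = DMLine 𝔐₀ G} (i , x , p) (i′ , x , q)
  line-≡ {i} {x = x} refl = cong (λ r → i , x , r) (≡-irrelevant _ _)

  κ″∘κ′≗id : ∀ a → κ″ 𝔐₀ G pf (κ′ 𝔐₀ G pf a) ≡ a
  κ″∘κ′≗id (i , _) = point-≡ (oneMinus-involutive i)

  κ′∘κ″≗id : ∀ l → κ′ 𝔐₀ G pf (κ″ 𝔐₀ G pf l) ≡ l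
  κ′∘κ″≗id (i , _) = line-≡ (oneMinus-involutive i)

  SymI-sym : ∀ x y → SymI 𝔐₀ G x y → SymI 𝔐₀ G y x
  SymI-sym (inj₁ _) (inj₂ _) inc = inc
  SymI-sym (inj₂ _) (inj₁ _) inc = inc

  oneMinus-reverses-incr : ∀ {i j} → i ≡ incr G j → oneMinus G j ≡ incr G (oneMinus G i)
  oneMinus-reverses-incr refl = sym (incr-oneMinus-incr _)

  κ-reversesIncidence : ReversesIncidence 𝔐 (κ′ 𝔐₀ G pf) (κ″ 𝔐₀ G pf)
  κ-reversesIncidence (i , x , _) (j , y , _) (inj₁ (i≡j , inc)) =
    inj₁ (cong (oneMinus G) (sym i≡j) , SymI-sym x y inc)
  κ-reversesIncidence (i , x , _) (j , y , _) (inj₂ (i≡j+1 , x≡y)) =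
    inj₂ (oneMinus-reverses-incr i≡j+1 , sym x≡y)

  dualMultiply-isInvolutiveCorrelation : IsInvolutiveCorrelation 𝔐 (κ′ 𝔐₀ G pf) (κ″ 𝔐₀ G pf)
  dualMultiply-isInvolutiveCorrelation =
    reversesIncidence⇒isInvolutiveCorrelation 𝔐 κ″∘κ′≗id κ′∘κ″≗id κ-reversesIncidence

isZeroℙ : Parity → Bool
isZeroℙ 0ℙ = true
isZeroℙ 1ℙ = false

%2≡ᵇ0≡isZeroℙ∘parity : ∀ m → (m % 2 ≡ᵇ 0) ≡ isZeroℙ (parity m)
%2≡ᵇ0≡isZeroℙ∘parity zero          = refl
%2≡ᵇ0≡isZeroℙ∘parity (suc zero)    = refl
%2≡ᵇ0≡isZeroℙ∘parity (suc (suc m)) = %2≡ᵇ0≡isZeroℙ∘parity m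

isZeroℙ-⁻¹ : ∀ p → isZeroℙ (p ⁻¹) ≡ not (isZeroℙ p)
isZeroℙ-⁻¹ 0ℙ = refl
isZeroℙ-⁻¹ 1ℙ = refl

oppositeParity⇒%2≡ᵇ0-not : ∀ m n → parity m ≡ parity n ⁻¹ → (m % 2 ≡ᵇ 0) ≡ not (n % 2 ≡ᵇ 0)
oppositeParity⇒%2≡ᵇ0-not m n pm≡pn⁻¹ = begin
  (m % 2 ≡ᵇ 0)               ≡⟨ %2≡ᵇ0≡isZeroℙ∘parity m ⟩
  isZeroℙ (parity m)         ≡⟨ cong isZeroℙ pm≡pn⁻¹ ⟩
  isZeroℙ (parity n ⁻¹)      ≡⟨ isZeroℙ-⁻¹ (parity n) ⟩
  not (isZeroℙ (parity n))   ≡⟨ cong not (%2≡ᵇ0≡isZeroℙ∘parity n) ⟨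
  not (n % 2 ≡ᵇ 0)           ∎

parity-suc : ∀ m → parity (suc m) ≡ parity m ⁻¹
parity-suc m = sym (⁻¹-selfInverse (suc-homo-⁻¹ m))

%2≡0⇒parity≡0ℙ : ∀ m → m % 2 ≡ 0 → parity m ≡ 0ℙ
%2≡0⇒parity≡0ℙ zero          _  = refl
%2≡0⇒parity≡0ℙ (suc (suc m)) eq = %2≡0⇒parity≡0ℙ m eq

⁻¹+⁻¹ : ∀ p q → p ⁻¹ ℙ.+ q ⁻¹ ≡ p ℙ.+ q
⁻¹+⁻¹ 0ℙ q = ⁻¹-selfInverse refl
⁻¹+⁻¹ 1ℙ q = refl

parity-∸ : ∀ m n → n ≤ m → parity (m ∸ n) ≡ parity m ℙ.+ parity n
parity-∸ m       zero    _         = sym (+-identityʳ (parity m))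
parity-∸ (suc m) (suc n) (s≤s n≤m) = begin
  parity (m ∸ n)                        ≡⟨ parity-∸ m n n≤m ⟩
  parity m ℙ.+ parity n                 ≡⟨ ⁻¹+⁻¹ (parity m) (parity n) ⟨
  parity m ⁻¹ ℙ.+ parity n ⁻¹           ≡⟨ cong₂ ℙ._+_ (parity-suc m) (parity-suc n) ⟨
  parity (suc m) ℙ.+ parity (suc n)     ∎

parity-∣1-i∣ : ∀ i → parity ∣ ℤ.1ℤ ℤ.- i ∣ ≡ parity ∣ i ∣ ⁻¹
parity-∣1-i∣ (+ zero)          = refl
parity-∣1-i∣ (+ suc zero)      = refl
parity-∣1-i∣ (+ suc (suc m))   = parity-suc m
parity-∣1-i∣ -[1+ m ]          = sym (suc-homo-⁻¹ m)

ℤ-oneMinusLaws : OneMinusLaws ℤG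
ℤ-oneMinusLaws = record
  { parityFlip          = λ i → oppositeParity⇒%2≡ᵇ0-not ∣ ℤ.1ℤ ℤ.- i ∣ ∣ i ∣ (parity-∣1-i∣ i)
  ; oneMinus-involutive = 1-[1-i]≡i
  ; incr-oneMinus-incr  = 1+[1-[1+j]]≡1-j
  }
  where
  1-[1-i]≡i : ∀ i → ℤ.1ℤ ℤ.- (ℤ.1ℤ ℤ.- i) ≡ i
  1-[1-i]≡i = solve-∀

  1+[1-[1+j]]≡1-j : ∀ j → ℤ.1ℤ ℤ.+ (ℤ.1ℤ ℤ.- (ℤ.1ℤ ℤ.+ j)) ≡ ℤ.1ℤ ℤ.- j
  1+[1-[1+j]]≡1-j = solve-∀

-- 1 − t modulo suc n, for t ≤ n; the value at t = 0 is right only when n ≥ 1.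
oneMinusℕ : ℕ → ℕ → ℕ
oneMinusℕ n zero          = 1
oneMinusℕ n (suc zero)    = 0
oneMinusℕ n (suc (suc t)) = n ∸ t

toℕ-oneMinus : ∀ {n} → 1 ≤ n → (i : Fin (suc n)) →
  toℕ (oneMinus (C (suc n)) i) ≡ oneMinusℕ n (toℕ i)
toℕ-oneMinus {n} 1≤n i = trans (toℕ-fromℕ< _) (reduce (toℕ i) (toℕ≤pred[n] i))
  where
  reduce : ∀ t → t ≤ n → (suc (suc n) ∸ t) % suc n ≡ oneMinusℕ n t
  reduce zero          _ = trans ([m+n]%n≡m%n 1 (suc n)) (m≤n⇒m%n≡m 1≤n)
  reduce (suc zero)    _ = n%n≡0 (suc n)
  reduce (suc (suc t)) _ = m≤n⇒m%n≡m (m∸n≤m n t)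

toℕ-incr : ∀ {n} (j : Fin (suc n)) → toℕ (incr (C (suc n)) j) ≡ suc (toℕ j) % suc n
toℕ-incr _ = toℕ-fromℕ< _

oneMinusℕ-involutive : ∀ {n} t → t ≤ n → oneMinusℕ n (oneMinusℕ n t) ≡ t
oneMinusℕ-involutive zero          _ = refl
oneMinusℕ-involutive (suc zero)    _ = refl
oneMinusℕ-involutive {suc (suc n)} (suc (suc t)) (s≤s (s≤s t≤n)) = begin
  oneMinusℕ (2 + n) (2 + n ∸ t)   ≡⟨ cong (oneMinusℕ (2 + n)) (+-∸-assoc 2 t≤n) ⟩
  2 + n ∸ (n ∸ t)                 ≡⟨ +-∸-assoc 2 (m∸n≤m n t) ⟩
  2 + (n ∸ (n ∸ t))               ≡⟨ cong (_+_ 2) (m∸[m∸n]≡n t≤n) ⟩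
  2 + t                           ∎

parity-oneMinusℕ : ∀ {n} → parity n ≡ 1ℙ → ∀ t → t ≤ n → parity (oneMinusℕ n t) ≡ parity t ⁻¹
parity-oneMinusℕ     _         zero          _  = refl
parity-oneMinusℕ     _         (suc zero)    _  = refl
parity-oneMinusℕ {n} odd (suc (suc t)) 2+t≤n = begin
  parity (n ∸ t)          ≡⟨ parity-∸ n t (m+n≤o⇒n≤o 2 2+t≤n) ⟩
  parity n ℙ.+ parity t   ≡⟨ cong (ℙ._+ parity t) odd ⟩
  parity t ⁻¹             ∎

suc-oneMinusℕ-suc : ∀ {n} t → t < n → suc (oneMinusℕ n (suc t)) % suc n ≡ oneMinusℕ n t
suc-oneMinusℕ-suc     zero          0<n   = m≤n⇒m%n≡m 0<n
suc-oneMinusℕ-suc {n} (suc zero)    _     = n%n≡0 (suc n)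
suc-oneMinusℕ-suc {n} (suc (suc u)) 2+u<n = begin
  suc (n ∸ suc u) % suc n   ≡⟨ cong (_% suc n) (+-∸-assoc 1 (m+n≤o⇒n≤o 2 2+u<n)) ⟨
  (n ∸ u) % suc n           ≡⟨ m≤n⇒m%n≡m (m∸n≤m n u) ⟩
  n ∸ u                     ∎

incr-oneMinusℕ-incr : ∀ {n} → 2 ≤ n → ∀ t → t ≤ n →
  suc (oneMinusℕ n (suc t % suc n)) % suc n ≡ oneMinusℕ n t
incr-oneMinusℕ-incr {n} 2≤n t t≤n with m≤n⇒m<n∨m≡n t≤n
... | inj₁ t<n = begin
  suc (oneMinusℕ n (suc t % suc n)) % suc n
    ≡⟨ cong (λ s → suc (oneMinusℕ n s) % suc n) (m≤n⇒m%n≡m t<n) ⟩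
  suc (oneMinusℕ n (suc t)) % suc n   ≡⟨ suc-oneMinusℕ-suc t t<n ⟩
  oneMinusℕ n t                       ∎
incr-oneMinusℕ-incr {suc zero}    (s≤s ()) _ _ | inj₂ refl
incr-oneMinusℕ-incr {suc (suc k)} 2≤n _ _ | inj₂ refl = begin
  suc (oneMinusℕ (2 + k) (suc (2 + k) % suc (2 + k))) % suc (2 + k)
    ≡⟨ cong (λ s → suc (oneMinusℕ (2 + k) s) % suc (2 + k)) (n%n≡0 (3 + k)) ⟩
  2 % (3 + k)                 ≡⟨ m≤n⇒m%n≡m 2≤n ⟩
  2                           ≡⟨ m+n∸n≡m 2 k ⟨
  oneMinusℕ (2 + k) (2 + k)   ∎

finite-oneMinusLaws : ∀ n → suc n % 2 ≡ 0 → 2 ≤ n → OneMinusLaws (C (suc n))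
finite-oneMinusLaws n even 2≤n = record
  { parityFlip          = parityFlip
  ; oneMinus-involutive = oneMinus-involutive
  ; incr-oneMinus-incr  = incr-oneMinus-incr
  }
  where
  G : CyclicGroup
  G = C (suc n)

  1≤n : 1 ≤ n
  1≤n = m+n≤o⇒n≤o 1 2≤n

  n-odd : parity n ≡ 1ℙ
  n-odd = trans (sym (suc-homo-⁻¹ n)) (cong _⁻¹ (%2≡0⇒parity≡0ℙ (suc n) even))

  parityFlip : ParityFlip G
  parityFlip i = oppositeParity⇒%2≡ᵇ0-not (toℕ (oneMinus G i)) (toℕ i) (begin
    parity (toℕ (oneMinus G i))   ≡⟨ cong parity (toℕ-oneMinus 1≤n i) ⟩
    parity (oneMinusℕ n (toℕ i))  ≡⟨ parity-oneMinusℕ n-odd (toℕ i) (toℕ≤pred[n] i) ⟩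
    parity (toℕ i) ⁻¹             ∎)

  oneMinus-involutive : ∀ i → oneMinus G (oneMinus G i) ≡ i
  oneMinus-involutive i = toℕ-injective (begin
    toℕ (oneMinus G (oneMinus G i))   ≡⟨ toℕ-oneMinus 1≤n (oneMinus G i) ⟩
    oneMinusℕ n (toℕ (oneMinus G i))  ≡⟨ cong (oneMinusℕ n) (toℕ-oneMinus 1≤n i) ⟩
    oneMinusℕ n (oneMinusℕ n (toℕ i)) ≡⟨ oneMinusℕ-involutive (toℕ i) (toℕ≤pred[n] i) ⟩
    toℕ i                             ∎)

  incr-oneMinus-incr : ∀ j → incr G (oneMinus G (incr G j)) ≡ oneMinus G j
  incr-oneMinus-incr j = toℕ-injective (begin
    toℕ (incr G (oneMinus G (incr G j)))
      ≡⟨ toℕ-incr (oneMinus G (incr G j)) ⟩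
    suc (toℕ (oneMinus G (incr G j))) % suc n
      ≡⟨ cong (λ s → suc s % suc n) (toℕ-oneMinus 1≤n (incr G j)) ⟩
    suc (oneMinusℕ n (toℕ (incr G j))) % suc n
      ≡⟨ cong (λ s → suc (oneMinusℕ n s) % suc n) (toℕ-incr j) ⟩
    suc (oneMinusℕ n (suc (toℕ j) % suc n)) % suc n
      ≡⟨ incr-oneMinusℕ-incr 2≤n (toℕ j) (toℕ≤pred[n] j) ⟩
    oneMinusℕ n (toℕ j)
      ≡⟨ toℕ-oneMinus 1≤n j ⟨
    toℕ (oneMinus G j)
      ∎)

admissible⇒oneMinusLaws : ∀ G → Admissible G → OneMinusLaws G
admissible⇒oneMinusLaws ℤG          _                = ℤ-oneMinusLaws
admissible⇒oneMinusLaws (C (suc n)) (even , s≤s 2≤n) = finite-oneMinusLaws n even 2≤n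

proposition2p3 : (𝔐₀ : Structure) → IsPLS 𝔐₀ → (G : CyclicGroup) → Admissible G →
    ParityFlip G
    × (∀ (pf : ParityFlip G) →
         IsInvolutiveCorrelation (DualMultiply 𝔐₀ G) (κ′ 𝔐₀ G pf) (κ″ 𝔐₀ G pf))
    × SelfDual (DualMultiply 𝔐₀ G)
proposition2p3 𝔐₀ _ G admissible =
    parityFlip
  , isInvolutiveCorrelation
  , (κ′ 𝔐₀ G parityFlip , κ″ 𝔐₀ G parityFlip , proj₁ (isInvolutiveCorrelation parityFlip))
  where
  laws : OneMinusLaws G
  laws = admissible⇒oneMinusLaws G admissible
  open OneMinusLaws laws using (parityFlip)

  isInvolutiveCorrelation : ∀ pf → IsInvolutiveCorrelation (DualMultiply 𝔐₀ G) (κ′ 𝔐₀ G pf) (κ″ 𝔐₀ G pf)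
  isInvolutiveCorrelation = dualMultiply-isInvolutiveCorrelation 𝔐₀ G laws
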